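{- Let $\Lambda=(B,K,\Theta)$ be a signature with parameter set $A$. If $(H,\diamond)$ is a $\natural$-stable head type then every $(H,\diamond)$-algebra is $\natural$-stable. Conversely, every $\natural$-stable bottomed $\Lambda$-algebra is a $\diamond$-algebra for some $\natural$-stable simple head type $\diamond$.
   Context: A signature is a triple $\Lambda=(B,K,\Theta)$ with $B,K$ non-empty sets and $\Theta$ assigning to each $k\in K$ a pair $(\underline{k},\overline{k})$, $\overline{k}\in B$, $\underline{k}:D_k\to B$ with $D_k$ finite. $K_b=\{k:\overline{k}=b\}$; parameter set $A=\{b:K_b=\emptyset\}$. For a $B$-family of sets $X$ and $\gamma:I\to B$ ($I$ finite), $[X]_\gamma$ is the set of maps $v$ on $I$ with $v(\eta)\in X_{\gamma(\eta)}$; for maps $\pi_b:X_b\to Y_b$, $[\pi]_\gamma(v)(\eta)=\pi_{\gamma(\eta)}(v(\eta))$. A bottomed set is a set with a distinguished element $\bot$; for a bottomed set $Z$, $Z^\natural=Z\setminus\{\bot\}$; a map is bottomed if it preserves bottoms, proper if moreover it maps non-bottom elements to non-bottom elements. A bottomed $\Lambda$-algebra is $(X,p)$ with $X$ a $B$-family of bottomed sets (bottoms $\bot_b$) and arbitrary maps $p_k:[X]_{\underline{k}}\to X_{\overline{k}}$; a bottomed homomorphism $\pi:(X,p)\to(Y,q)$ is a family of bottomed maps with $q_k\circ[\pi]_{\underline{k}}=\pi_{\overline{k}}\circ p_k$. A bottomed $\Lambda$-algebra $(Y,q)$ is $\natural$-stable if whenever $k\in K$ and $v_1,v_2\in[Y]_{\underline{k}}$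 satisfy $q_k(v_1)\in Y_{\overline{k}}^\natural$ and $v_2(\eta)\in Y^\natural_{\underline{k}(\eta)}$ for all $\eta\in D_k$ with $v_1(\eta)\in Y^\natural_{\underline{k}(\eta)}$, then $q_k(v_2)\in Y^\natural_{\overline{k}}$. Let $\mathbb{T}=\{\bot,\natural\}$ be bottomed with bottom $\bot$. A head type is a bottomed $\Lambda$-algebra $(H,\diamond)$ with $H_a=\mathbb{T}$ for all $a\in A$; it is simple if $H_b=\mathbb{T}$ for all $b\in B$ (then written just $\diamond$), and $\natural$-stable if it is $\natural$-stable as a bottomed $\Lambda$-algebra. A bottomed $\Lambda$-algebra is an $(H,\diamond)$-algebra if there is a bottomed homomorphism from it to $(H,\diamond)$ all of whose components are proper. -}

module Defs where

open import Data.Nat using (ℕ)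
open import Data.Fin using (Fin)
open import Data.Product using (Σ; _×_)
open import Data.Empty using (⊥)
open import Relation.Nullary using (¬_)
open import Relation.Binary.PropositionalEquality using (_≡_)

-- A signature Λ = (B, K, Θ).  D_k is a finite set, represented as Fin (arity k);
-- Θ(k) = (k̲ , k̄) with k̲ = dom k : D_k → B and k̄ = cod k ∈ B.
record Signature : Set₁ where
  field
    B     : Set
    K     : Set
    b₀    : B
    k₀    : K
    arity : K → ℕ
    dom   : (k : K) → Fin (arity k) → B
    cod   : K → B
open Signature public

IsParam : (Λ : Signature) → B Λ → Set
IsParam Λ b = (k : K Λ) → ¬ (cod Λ k ≡ b)

record BSet : Set₁ where
  field
    Car : Set
    bot : Car
open BSet public

NonBot : (Z : BSet) → Car Z → Set
NonBot Z x = ¬ (x ≡ bot Z)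

IsBottomed : (Z W : BSet) → (Car Z → Car W) → Set
IsBottomed Z W f = f (bot Z) ≡ bot W

IsProper : (Z W : BSet) → (Car Z → Car W) → Set
IsProper Z W f = IsBottomed Z W f × ((x : Car Z) → NonBot Z x → NonBot W (f x))

data T : Set where
  tbot : T
  tnat : T

𝕋 : BSet
𝕋 = record { Car = T ; bot = tbot }

module _ (Λ : Signature) where

  Args : (X : B Λ → BSet) → K Λ → Set
  Args X k = (η : Fin (arity Λ k)) → Car (X (dom Λ k η))

  record BAlg : Set₁ where
    field
      Fam : B Λ → BSet
      op  : (k : K Λ) → Args Fam k → Car (Fam (cod Λ k))
  open BAlg public

  record BHom (X Y : BAlg) : Set where
    field
      map      : (b : B Λ) → Car (Fam X b) → Car (Fam Y b)
      bottomed : (b : B Λ) → IsBottomed (Fam X b) (Fam Y b) (map b)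
      commutes : (k : K Λ) (v : Args (Fam X) k) →
                 op Y k (λ η → map (dom Λ k η) (v η)) ≡ map (cod Λ k) (op X k v)
  open BHom public

  IsProperHom : {X Y : BAlg} → BHom X Y → Set
  IsProperHom {X} {Y} π = (b : B Λ) → (x : Car (Fam X b)) →
    NonBot (Fam X b) x → NonBot (Fam Y b) (map π b x)

  ♮Stable : BAlg → Set
  ♮Stable Y = (k : K Λ) (v₁ v₂ : Args (Fam Y) k) →
    NonBot (Fam Y (cod Λ k)) (op Y k v₁) →
    ((η : Fin (arity Λ k)) → NonBot (Fam Y (dom Λ k η)) (v₁ η) →
                             NonBot (Fam Y (dom Λ k η)) (v₂ η)) →
    NonBot (Fam Y (cod Λ k)) (op Y k v₂)

  record HeadType : Set₁ where
    field
      alg     : BAlg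
      param𝕋  : (a : B Λ) → IsParam Λ a → Fam alg a ≡ 𝕋
  open HeadType public

  SimpleOps : Set
  SimpleOps = (k : K Λ) → ((η : Fin (arity Λ k)) → T) → T

  simpleAlg : SimpleOps → BAlg
  simpleAlg ◇ = record { Fam = λ _ → 𝕋 ; op = ◇ }

  simpleHead : SimpleOps → HeadType
  simpleHead ◇ = record { alg = simpleAlg ◇ ; param𝕋 = λ _ _ → _≡_.refl }

  IsHeadAlgebra : HeadType → BAlg → Set
  IsHeadAlgebra H Y = Σ (BHom Y (alg H)) IsProperHom

-- ♮-stability is reflected by proper bottomed homomorphisms π: if q_k v₁ is non-bottom then
-- so is its image under π, stability of the target transfers this to the image of v₂
-- (π reflects non-bottomness since it is bottomed), and π(q_k v₂) ≠ ⊥ forces q_k v₂ ≠ ⊥.  Conversely, for a ♮-stable Y the map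
-- sending y to ♮ exactly when y is non-bottom is a proper homomorphism onto the simple head
-- type whose ◇_k(t) is ♮ iff some argument with non-bottom value under q_k is non-bottom
-- only where t is ♮; ♮-stability of Y is exactly what makes this map commute with q_k.
module Submission where

open import Defs
open import Data.Product using (Σ; _×_; _,_)
open import Axiom.ExcludedMiddle using (ExcludedMiddle)
open import Level using (0ℓ)
open import Data.Fin using (Fin)
open import Data.Empty using (⊥-elim)
open import Relation.Nullary using (Dec; yes; no)
open import Relation.Binary.PropositionalEquality using (_≡_; refl; sym; trans; cong; module ≡-Reasoning)

nonBot-reflect : (Z W : BSet) (f : Car Z → Car W) → IsBottomed Z W f →
                 (x : Car Z) → NonBot W (f x) → NonBot Z x
nonBot-reflect Z W f f⊥ x fx♮ refl = fx♮ f⊥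

♮Stable-reflect : (Λ : Signature) {X Y : BAlg Λ} (π : BHom Λ X Y) →
                  IsProperHom Λ π → ♮Stable Λ Y → ♮Stable Λ X
♮Stable-reflect Λ {X} {Y} π proper Y-stable k v₁ v₂ v₁♮ shape v₂⊥ =
  πv₂♮ (begin
    op Y k (λ η → map π (dom Λ k η) (v₂ η)) ≡⟨ commutes π k v₂ ⟩
    map π (cod Λ k) (op X k v₂)              ≡⟨ cong (map π (cod Λ k)) v₂⊥ ⟩
    map π (cod Λ k) (bot (Fam X (cod Λ k)))  ≡⟨ bottomed π (cod Λ k) ⟩
    bot (Fam Y (cod Λ k))                    ∎)
  where
  open ≡-Reasoning

  πv₁♮ : NonBot (Fam Y (cod Λ k)) (op Y k (λ η → map π (dom Λ k η) (v₁ η)))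
  πv₁♮ e = proper (cod Λ k) (op X k v₁) v₁♮ (trans (sym (commutes π k v₁)) e)

  πv₂♮ : NonBot (Fam Y (cod Λ k)) (op Y k (λ η → map π (dom Λ k η) (v₂ η)))
  πv₂♮ = Y-stable k _ _ πv₁♮ λ η πv₁η♮ →
    proper (dom Λ k η) (v₂ η)
      (shape η (nonBot-reflect (Fam X (dom Λ k η)) (Fam Y (dom Λ k η))
                   (map π (dom Λ k η)) (bottomed π (dom Λ k η)) (v₁ η) πv₁η♮))

nonBot𝕋⇒≡tnat : (t : T) → NonBot 𝕋 t → t ≡ tnat
nonBot𝕋⇒≡tnat tbot t♮ = ⊥-elim (t♮ refl)
nonBot𝕋⇒≡tnat tnat _ = refl

≡tnat⇒nonBot𝕋 : (t : T) → t ≡ tnat → NonBot 𝕋 t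
≡tnat⇒nonBot𝕋 .tnat refl ()

⌜_⌝ : {P : Set} → Dec P → T
⌜ yes _ ⌝ = tnat
⌜ no _ ⌝ = tbot

⌜⌝-complete : {P : Set} (d : Dec P) → P → ⌜ d ⌝ ≡ tnat
⌜⌝-complete (yes _) _ = refl
⌜⌝-complete (no ¬p) p = ⊥-elim (¬p p)

⌜⌝-sound : {P : Set} (d : Dec P) → NonBot 𝕋 ⌜ d ⌝ → P
⌜⌝-sound (yes p) _ = p
⌜⌝-sound (no _) d♮ = ⊥-elim (d♮ refl)

module SupportHead (lem : ExcludedMiddle 0ℓ) (Λ : Signature) (Y : BAlg Λ) where

  Realised : (k : K Λ) → (Fin (arity Λ k) → T) → Set
  Realised k t = Σ (Args Λ (Fam Y) k) λ w → NonBot (Fam Y (cod Λ k)) (op Y k w) ×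
                   ((η : Fin (arity Λ k)) → NonBot (Fam Y (dom Λ k η)) (w η) → t η ≡ tnat)

  supportOps : SimpleOps Λ
  supportOps k t = ⌜ lem {Realised k t} ⌝

  support : (b : B Λ) → Car (Fam Y b) → T
  support b y = ⌜ lem {NonBot (Fam Y b) y} ⌝

  support-bottomed : (b : B Λ) → support b (bot (Fam Y b)) ≡ tbot
  support-bottomed b with lem {NonBot (Fam Y b) (bot (Fam Y b))}
  ... | yes ⊥♮ = ⊥-elim (⊥♮ refl)
  ... | no _ = refl

  support-proper : (b : B Λ) (y : Car (Fam Y b)) → NonBot (Fam Y b) y → NonBot 𝕋 (support b y)
  support-proper b y y♮ = ≡tnat⇒nonBot𝕋 _ (⌜⌝-complete lem y♮)

  support-commutes : ♮Stable Λ Y → (k : K Λ) (v : Args Λ (Fam Y) k) →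
    supportOps k (λ η → support (dom Λ k η) (v η)) ≡ support (cod Λ k) (op Y k v)
  support-commutes Y-stable k v with lem {NonBot (Fam Y (cod Λ k)) (op Y k v)}
  ... | yes v♮ = ⌜⌝-complete lem (v , v♮ , λ η → ⌜⌝-complete lem)
  ... | no v⊥ with lem {Realised k (λ η → support (dom Λ k η) (v η))}
  ...   | no _ = refl
  ...   | yes (w , w♮ , shape) =
          ⊥-elim (v⊥ (Y-stable k w v w♮ λ η w♮η →
                        ⌜⌝-sound lem (≡tnat⇒nonBot𝕋 _ (shape η w♮η))))

  supportOps-♮Stable : ♮Stable Λ (simpleAlg Λ supportOps)
  supportOps-♮Stable k t₁ t₂ t₁♮ t₁≤t₂ with ⌜⌝-sound lem t₁♮
  ... | (w , w♮ , shape) =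
        ≡tnat⇒nonBot𝕋 _ (⌜⌝-complete lem (w , w♮ , λ η w♮η →
          nonBot𝕋⇒≡tnat _ (t₁≤t₂ η (≡tnat⇒nonBot𝕋 _ (shape η w♮η)))))

  supportHom : ♮Stable Λ Y → BHom Λ Y (simpleAlg Λ supportOps)
  supportHom Y-stable = record
    { map = support ; bottomed = support-bottomed ; commutes = support-commutes Y-stable }

proposition3p3p5 : ExcludedMiddle 0ℓ → (Λ : Signature) →
    ((H : HeadType Λ) → ♮Stable Λ (alg H) →
       (Y : BAlg Λ) → IsHeadAlgebra Λ H Y → ♮Stable Λ Y)
    × ((Y : BAlg Λ) → ♮Stable Λ Y →
       Σ (SimpleOps Λ) (λ ◇ → ♮Stable Λ (simpleAlg Λ ◇) × IsHeadAlgebra Λ (simpleHead Λ ◇) Y))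
proposition3p3p5 lem Λ =
  (λ H H-stable Y (π , proper) → ♮Stable-reflect Λ π proper H-stable) ,
  λ Y Y-stable → let open SupportHead lem Λ Y in
    supportOps , supportOps-♮Stable , supportHom Y-stable , support-proper
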